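{- Let $d>1$ be an integer, $q$ a prime power with $q\equiv 1\pmod d$, and $\omega\in\mathbb{F}_q$ a primitive $d$-th root of unity. For $0\le i\le d-1$ let $$A_i(x)=x^{q^{d-1}}+\omega^i x^{q^{d-2}}+\cdots+\omega^{i(d-1)}x.$$ Then, as functions on $\mathbb{F}_{q^d}$: (i) $A_i(x)^q=\omega^iA_i(x)$ for $0\le i\le d-1$; (ii) for every positive integer $m$ and integers $0\le i,j\le d-1$, $$A_j\big(A_i(x)^m\big)=\begin{cases} d\,\omega^{ -j}A_i(x)^m, & \text{if } j\equiv im\pmod d,\\ 0, & \text{otherwise.}\end{cases}$$ -}

module Defs where

open import Level using (Level; suc; _⊔_)
open import Data.Nat using (ℕ)
import Data.Nat as ℕ
open import Data.Fin using (Fin; toℕ)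
open import Relation.Nullary using (¬_)
open import Algebra.Bundles using (CommutativeRing; Semiring)
import Algebra.Definitions.RawSemiring as RawSemiringDefs

-- A field: a commutative ring with 1 ≉ 0 and a multiplicative inverse
-- for every nonzero element.  The inverse is a total operation (its value
-- at 0 is unconstrained), as in Mathlib.
record Field (c ℓ : Level) : Set (suc (c ⊔ ℓ)) where
  field
    commutativeRing : CommutativeRing c ℓ
  open CommutativeRing commutativeRing public
  field
    _⁻¹      : Carrier → Carrier
    ⁻¹-cong  : ∀ {x y} → x ≈ y → x ⁻¹ ≈ y ⁻¹
    1≉0      : ¬ (1# ≈ 0#)
    ⁻¹-inverseʳ : ∀ x → ¬ (x ≈ 0#) → x * (x ⁻¹) ≈ 1#
  open RawSemiringDefs (Semiring.rawSemiring semiring) public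
    using (_×_; sum)
    renaming (_^_ to _^ᶠ_)

module _ {c ℓ} (F : Field c ℓ) where
  open Field F

  A : (q d : ℕ) (ω : Carrier) (i : ℕ) → Carrier → Carrier
  A q d ω i x = sum {d} (λ (k : Fin d) → (ω ^ᶠ (i ℕ.* toℕ k)) * (x ^ᶠ (q ℕ.^ (d ℕ.∸ 1 ℕ.∸ toℕ k))))

module Submission where

-- Write φ x = x ^ q.  As |𝔽| = p ^ (k d), the characteristic of 𝔽 is p, so φ is additive (the
-- binomial coefficients C(p, i), 0 < i < p, vanish), and φ^d is the identity (Fermat).  Since
-- A_i(x) = Σ_k ω^(ik) φ^(d-1-k)(x), applying φ shifts the summation index cyclically, which by
-- ω^d = 1 amounts to multiplying by ω^i: this is (i).  Hence y = A_i(x)^m satisfies φ y = c y with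
-- c = ω^(im), so A_j(y) = S y with S = Σ_k ω^(jk) c^(d-1-k).  If ω^j = c every summand is ω^(-j);
-- otherwise the same cyclic shift gives c S = ω^j S, whence S = 0.  Finally ω has order exactly d,
-- so ω^j = ω^(im) iff d divides j - im.

open import Level using (Level)
open import Data.Nat as ℕ using (ℕ; zero; suc)
open import Data.Fin as Fin using (Fin; toℕ)
open import Data.Sum using (inj₁; inj₂)
open import Data.Product using (_,_)
open import Relation.Nullary using (¬_; yes; no; contradiction)
open import Relation.Binary.PropositionalEquality as ≡ using (_≡_)
open import Relation.Binary.PropositionalEquality.Properties using () renaming (setoid to ≡-setoid)
open import Function.Base using (_∘_; id)
open import Function.Bundles using (Inverse)
open import Relation.Binary.Bundles using (Setoid)
open import Algebra.Bundles using (CommutativeMonoid; CommutativeRing)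
open import Data.Nat.Primality using (Prime; ¬prime[0]; ¬prime[1]; euclidsLemma; prime⇒nonZero)
open import Defs

module _ where
  open import Data.Nat
  open import Data.Nat.Properties
  open import Data.Nat.Divisibility
  open import Data.Nat.Combinatorics
  open import Data.Nat.DivMod using (m/n*n≡m)

  prime∤! : ∀ {p m} → Prime p → m < p → p ∤ m !
  prime∤! {m = zero}  pp _   p∣1    = ¬prime[1] (≡.subst Prime (∣1⇒≡1 p∣1) pp)
  prime∤! {m = suc m} pp m<p p∣m+1! with euclidsLemma (suc m) (m !) pp p∣m+1!
  ... | inj₁ p∣m+1 = <⇒≱ m<p (∣⇒≤ p∣m+1)
  ... | inj₂ p∣m!  = prime∤! pp (<-trans (n<1+n m) m<p) p∣m!

  n∣n! : ∀ n .{{_ : NonZero n}} → n ∣ n !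
  n∣n! (suc n) = m∣m*n (n !)

  nCk*k!*[n∸k]!≡n! : ∀ {n k} → k ≤ n → (n C k) * (k ! * (n ∸ k) !) ≡ n !
  nCk*k!*[n∸k]!≡n! {n} {k} k≤n = ≡.trans (≡.cong (_* (k ! * (n ∸ k) !)) (nCk≡n!/k![n-k]! k≤n))
                                         (m/n*n≡m (k![n∸k]!∣n! k≤n))
    where instance _ = k !* (n ∸ k) !≢0

  prime∣C : ∀ {p k} → Prime p → 0 < k → k < p → p ∣ p C k
  prime∣C {p} {k} pp 0<k k<p
    with euclidsLemma (p C k) (k ! * (p ∸ k) !) pp p∣C*k!*[p∸k]!
    where
    instance _ = prime⇒nonZero pp
    p∣C*k!*[p∸k]! : p ∣ (p C k) * (k ! * (p ∸ k) !)
    p∣C*k!*[p∸k]! = ≡.subst (p ∣_) (≡.sym (nCk*k!*[n∸k]!≡n! (<⇒≤ k<p))) (n∣n! p)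
  ... | inj₁ p∣C = p∣C
  ... | inj₂ p∣k!*[p∸k]! with euclidsLemma (k !) ((p ∸ k) !) pp p∣k!*[p∸k]!
  ...   | inj₁ p∣k!     = contradiction p∣k! (prime∤! pp k<p)
  ...   | inj₂ p∣[p∸k]! = contradiction p∣[p∸k]! (prime∤! pp (∸-monoʳ-< 0<k (<⇒≤ k<p)))

module _ {ℓ₁ ℓ₂} (R : CommutativeRing ℓ₁ ℓ₂) where
  open CommutativeRing R
  open import Relation.Binary.Reasoning.Setoid setoid
  open import Algebra.Properties.Semiring.Mult semiring
  open import Algebra.Properties.Semiring.Exp semiring
  open import Algebra.Properties.Semiring.Sum semiring using (sum; sum-init-last; sum-cong-≋; sum-replicate-zero; *-distribˡ-sum)
  open import Algebra.Properties.CommutativeSemiring.Binomial commutativeSemiring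
  open import Algebra.Properties.Ring ring using (x+x≈x⇒x≈0)
  open import Data.Nat.Divisibility using (_∣_; divides-refl)
  open import Data.Nat.Combinatorics using (nCn≡1)
  open import Data.Fin.Properties using (toℕ-fromℕ; toℕ-inject₁; toℕ<n)
  open import Data.Nat.Properties using (n∸n≡0)
  import Data.Nat.Properties as ℕ
  open import Algebra.Properties.CommutativeSemiring.Exp commutativeSemiring using (^-distrib-*)
  open import Data.Nat using (s≤s; z≤n)

  ×1-homo-^ : ∀ m e → (m ℕ.^ e) × 1# ≈ (m × 1#) ^ e
  ×1-homo-^ m zero    = +-identityʳ 1#
  ×1-homo-^ m (suc e) = trans (×1-homo-* m (m ℕ.^ e)) (*-congˡ (×1-homo-^ m e))

  p∣n⇒n×x≈0 : ∀ {p n} → p × 1# ≈ 0# → p ∣ n → ∀ x → n × x ≈ 0#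
  p∣n⇒n×x≈0 {p} p×1≈0 (divides-refl m) x = begin
    (m ℕ.* p) × x                ≈⟨ ×-congʳ (m ℕ.* p) (*-identityˡ x) ⟨
    (m ℕ.* p) × (1# * x)         ≈⟨ ×-assoc-* (m ℕ.* p) 1# x ⟨
    ((m ℕ.* p) × 1#) * x         ≈⟨ *-congʳ (×1-homo-* m p) ⟩
    ((m × 1#) * (p × 1#)) * x    ≈⟨ *-congʳ (*-congˡ p×1≈0) ⟩
    ((m × 1#) * 0#) * x          ≈⟨ *-congʳ (zeroʳ _) ⟩
    0# * x                       ≈⟨ zeroˡ x ⟩
    0#                           ∎

  ^p-distrib-+ : ∀ {p} → Prime p → p × 1# ≈ 0# → ∀ x y → (x + y) ^ p ≈ x ^ p + y ^ p
  ^p-distrib-+ {0}           pp = contradiction pp ¬prime[0]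
  ^p-distrib-+ {1}           pp = contradiction pp ¬prime[1]
  ^p-distrib-+ {p@(suc (suc r))} pp p×1≈0 x y = begin
    (x + y) ^ p                                             ≈⟨ theorem p x y ⟩
    T Fin.zero + sum (T ∘ Fin.suc)                          ≈⟨ +-congˡ (sum-init-last (T ∘ Fin.suc)) ⟩
    T Fin.zero + (sum (T ∘ Fin.suc ∘ Fin.inject₁) + T (Fin.suc (Fin.fromℕ (suc r))))
      ≈⟨ +-cong first (+-cong inner last) ⟩
    y ^ p + (0# + x ^ p)                                    ≈⟨ +-congˡ (+-identityˡ _) ⟩
    y ^ p + x ^ p                                           ≈⟨ +-comm _ _ ⟩
    x ^ p + y ^ p                                           ∎
    where
    T = binomialTerm x y p
    first : T Fin.zero ≈ y ^ p
    first = trans (+-identityʳ _) (*-identityˡ _)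
    inner : sum (T ∘ Fin.suc ∘ Fin.inject₁) ≈ 0#
    inner = trans (sum-cong-≋ T[1+i]≈0) (sum-replicate-zero (suc r))
      where
      T[1+i]≈0 : ∀ (i : Fin (suc r)) → T (Fin.suc (Fin.inject₁ i)) ≈ 0#
      T[1+i]≈0 i = p∣n⇒n×x≈0 p×1≈0 (prime∣C pp (s≤s z≤n) (s≤s i<1+r)) (binomial x y p (Fin.suc (Fin.inject₁ i)))
        where
        i<1+r : toℕ (Fin.inject₁ i) ℕ.< suc r
        i<1+r = ≡.subst (ℕ._< suc r) (≡.sym (toℕ-inject₁ i)) (toℕ<n i)
    last : T (Fin.suc (Fin.fromℕ (suc r))) ≈ x ^ p
    last rewrite toℕ-fromℕ r | nCn≡1 p | n∸n≡0 r = trans (+-identityʳ _) (*-identityʳ _)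

  ^[p^e]-distrib-+ : ∀ {p} → Prime p → p × 1# ≈ 0# → ∀ e x y → (x + y) ^ (p ℕ.^ e) ≈ x ^ (p ℕ.^ e) + y ^ (p ℕ.^ e)
  ^[p^e]-distrib-+ pp p×1≈0 zero    x y = trans (*-identityʳ _) (sym (+-cong (*-identityʳ x) (*-identityʳ y)))
  ^[p^e]-distrib-+ {p} pp p×1≈0 (suc e) x y = begin
    (x + y) ^ (p ℕ.* p ℕ.^ e)                     ≈⟨ ^-assocʳ (x + y) p (p ℕ.^ e) ⟨
    ((x + y) ^ p) ^ (p ℕ.^ e)                     ≈⟨ ^-congˡ (p ℕ.^ e) (^p-distrib-+ pp p×1≈0 x y) ⟩
    (x ^ p + y ^ p) ^ (p ℕ.^ e)                   ≈⟨ ^[p^e]-distrib-+ pp p×1≈0 e (x ^ p) (y ^ p) ⟩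
    (x ^ p) ^ (p ℕ.^ e) + (y ^ p) ^ (p ℕ.^ e)     ≈⟨ +-cong (^-assocʳ x p (p ℕ.^ e)) (^-assocʳ y p (p ℕ.^ e)) ⟩
    x ^ (p ℕ.* p ℕ.^ e) + y ^ (p ℕ.* p ℕ.^ e)     ∎

  ^-distrib-sum : ∀ {q} → (∀ x y → (x + y) ^ q ≈ x ^ q + y ^ q) →
                  ∀ {n} (f : Fin n → Carrier) → sum f ^ q ≈ sum (λ k → f k ^ q)
  ^-distrib-sum {q} ^q-distrib-+ {zero}  f = x+x≈x⇒x≈0 (0# ^ q) (trans (sym (^q-distrib-+ 0# 0#)) (^-congˡ q (+-identityʳ 0#)))
  ^-distrib-sum {q} ^q-distrib-+ {suc n} f = trans (^q-distrib-+ _ _) (+-congˡ (^-distrib-sum {q} ^q-distrib-+ (f ∘ Fin.suc)))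

  x^q≈x⇒[x^a]^q≈x^a : ∀ {q x} → x ^ q ≈ x → ∀ a → (x ^ a) ^ q ≈ x ^ a
  x^q≈x⇒[x^a]^q≈x^a {q} {x} x^q≈x a = begin
    (x ^ a) ^ q           ≈⟨ ^-assocʳ x a q ⟩
    x ^ (a ℕ.* q)         ≡⟨ ≡.cong (x ^_) (ℕ.*-comm a q) ⟩
    x ^ (q ℕ.* a)         ≈⟨ ^-assocʳ x q a ⟨
    (x ^ q) ^ a           ≈⟨ ^-congˡ a x^q≈x ⟩
    x ^ a                 ∎

  x^q≈x⇒x^[q^t]≈x : ∀ {q x} → x ^ q ≈ x → ∀ t → x ^ (q ℕ.^ t) ≈ x
  x^q≈x⇒x^[q^t]≈x x^q≈x zero    = *-identityʳ _
  x^q≈x⇒x^[q^t]≈x {q} {x} x^q≈x (suc t) = begin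
    x ^ (q ℕ.* q ℕ.^ t)   ≈⟨ ^-assocʳ x q (q ℕ.^ t) ⟨
    (x ^ q) ^ (q ℕ.^ t)   ≈⟨ ^-congˡ (q ℕ.^ t) x^q≈x ⟩
    x ^ (q ℕ.^ t)         ≈⟨ x^q≈x⇒x^[q^t]≈x x^q≈x t ⟩
    x                     ∎

  y^q≈c*y⇒y^[q^t]≈cᵗ*y : ∀ {q c y} → c ^ q ≈ c → y ^ q ≈ c * y → ∀ t → y ^ (q ℕ.^ t) ≈ c ^ t * y
  y^q≈c*y⇒y^[q^t]≈cᵗ*y c^q≈c y^q≈cy zero    = trans (*-identityʳ _) (sym (*-identityˡ _))
  y^q≈c*y⇒y^[q^t]≈cᵗ*y {q} {c} {y} c^q≈c y^q≈cy (suc t) = begin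
    y ^ (q ℕ.* q ℕ.^ t)               ≈⟨ ^-assocʳ y q (q ℕ.^ t) ⟨
    (y ^ q) ^ (q ℕ.^ t)               ≈⟨ ^-congˡ (q ℕ.^ t) y^q≈cy ⟩
    (c * y) ^ (q ℕ.^ t)               ≈⟨ ^-distrib-* c y (q ℕ.^ t) ⟩
    c ^ (q ℕ.^ t) * y ^ (q ℕ.^ t)     ≈⟨ *-cong (x^q≈x⇒x^[q^t]≈x c^q≈c t) (y^q≈c*y⇒y^[q^t]≈cᵗ*y c^q≈c y^q≈cy t) ⟩
    c * (c ^ t * y)                   ≈⟨ *-assoc c (c ^ t) y ⟨
    c ^ suc t * y                     ∎

  y^q≈a*y⇒[yᵐ]^q≈aᵐ*yᵐ : ∀ {q a y} → y ^ q ≈ a * y → ∀ m → (y ^ m) ^ q ≈ a ^ m * y ^ m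
  y^q≈a*y⇒[yᵐ]^q≈aᵐ*yᵐ {q} {a} {y} y^q≈ay m = begin
    (y ^ m) ^ q           ≈⟨ ^-assocʳ y m q ⟩
    y ^ (m ℕ.* q)         ≡⟨ ≡.cong (y ^_) (ℕ.*-comm m q) ⟩
    y ^ (q ℕ.* m)         ≈⟨ ^-assocʳ y q m ⟨
    (y ^ q) ^ m           ≈⟨ ^-congˡ m y^q≈ay ⟩
    (a * y) ^ m           ≈⟨ ^-distrib-* a y m ⟩
    a ^ m * y ^ m         ∎

  sum-rotate : ∀ {n} a (b : ℕ → Carrier) → a ^ suc n ≈ 1# → b (suc n) ≈ b 0 →
               sum {suc n} (λ k → a ^ toℕ k * b (suc n ℕ.∸ toℕ k)) ≈
               a * sum {suc n} (λ k → a ^ toℕ k * b (n ℕ.∸ toℕ k))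
  sum-rotate {n} a b aᵈ≈1 bᵈ≈b₀ = begin
    1# * b (suc n) + sum {n} (λ k → a ^ suc (toℕ k) * b (n ℕ.∸ toℕ k))
      ≈⟨ +-cong (trans (*-identityˡ _) bᵈ≈b₀) (sum-cong-≋ {n} inner) ⟩
    b 0 + sum {n} (λ k → g (Fin.inject₁ k))                    ≈⟨ +-comm _ _ ⟩
    sum {n} (λ k → g (Fin.inject₁ k)) + b 0                    ≈⟨ +-congˡ last ⟨
    sum {n} (λ k → g (Fin.inject₁ k)) + g (Fin.fromℕ n)        ≈⟨ sum-init-last g ⟨
    sum g                                                  ≈⟨ *-distribˡ-sum a f ⟨
    a * sum f                                              ∎
    where
    f g : Fin (suc n) → Carrier
    f k = a ^ toℕ k * b (n ℕ.∸ toℕ k)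
    g k = a * f k
    inner : ∀ k → a ^ suc (toℕ k) * b (n ℕ.∸ toℕ k) ≈ g (Fin.inject₁ k)
    inner k = trans (*-assoc a _ _) (*-congˡ (reflexive (≡.cong (λ t → a ^ t * b (n ℕ.∸ t)) (≡.sym (toℕ-inject₁ k)))))
    last : g (Fin.fromℕ n) ≈ b 0
    last = begin
      a * (a ^ toℕ (Fin.fromℕ n) * b (n ℕ.∸ toℕ (Fin.fromℕ n)))
        ≡⟨ ≡.cong (λ t → a * (a ^ t * b (n ℕ.∸ t))) (toℕ-fromℕ n) ⟩
      a * (a ^ n * b (n ℕ.∸ n))        ≈⟨ *-assoc a _ _ ⟨
      a ^ suc n * b (n ℕ.∸ n)          ≡⟨ ≡.cong (λ t → a ^ suc n * b t) (n∸n≡0 n) ⟩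
      a ^ suc n * b 0                  ≈⟨ *-congʳ aᵈ≈1 ⟩
      1# * b 0                         ≈⟨ *-identityˡ _ ⟩
      b 0                              ∎

module _ {ℓ₁ ℓ₂} (M : CommutativeMonoid ℓ₁ ℓ₂) {N : ℕ}
         (enum : Inverse (CommutativeMonoid.setoid M) (≡-setoid (Fin N))) where
  open CommutativeMonoid M
  open import Algebra.Properties.CommutativeMonoid.Sum M using (sum; sum-cong-≋; sum-permute)
  open import Function.Definitions using (Congruent)
  import Function.Construct.Composition as Comp
  import Function.Construct.Symmetry as Sym
  open Inverse enum using (from; strictlyInverseʳ)

  sumOver : (Carrier → Carrier) → Carrier
  sumOver g = sum (g ∘ from)

  sumOver-reindex : (σ : Inverse setoid setoid) → ∀ {g} → Congruent _≈_ _≈_ g →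
                    sumOver g ≈ sumOver (g ∘ Inverse.to σ)
  sumOver-reindex σ {g} g-cong =
    trans (sum-permute (g ∘ from) (Comp.inverse (Sym.inverse enum) (Comp.inverse σ enum)))
          (sum-cong-≋ {N} (λ i → g-cong (strictlyInverseʳ (Inverse.to σ (from i)))))


module _ {ℓ₁ ℓ₂} (S : Setoid ℓ₁ ℓ₂) where
  open Setoid S
  open import Function.Definitions using (Congruent)
  open import Function.Consequences.Setoid S S using (strictlyInverseˡ⇒inverseˡ; strictlyInverseʳ⇒inverseʳ)

  mkPermutation : (f g : Carrier → Carrier) → Congruent _≈_ _≈_ f → Congruent _≈_ _≈_ g →
                  (∀ x → f (g x) ≈ x) → (∀ x → g (f x) ≈ x) → Inverse S S
  mkPermutation f g f-cong g-cong fg≈id gf≈id = record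
    { to        = f
    ; from      = g
    ; to-cong   = f-cong
    ; from-cong = g-cong
    ; inverse   = strictlyInverseˡ⇒inverseˡ f-cong fg≈id , strictlyInverseʳ⇒inverseʳ g-cong gf≈id
    }

module _ {ℓ₁ ℓ₂} (F : Field ℓ₁ ℓ₂) where
  open Field F
  open import Relation.Binary.Reasoning.Setoid setoid
  open import Algebra.Properties.Ring ring using ([y-z]x≈yx-zx; x∙y⁻¹≈ε⇒x≈y)

  x≉0∧x*y≈0⇒y≈0 : ∀ {x y} → ¬ x ≈ 0# → x * y ≈ 0# → y ≈ 0#
  x≉0∧x*y≈0⇒y≈0 {x} {y} x≉0 x*y≈0 = begin
    y                 ≈⟨ *-identityˡ y ⟨
    1# * y            ≈⟨ *-congʳ (trans (*-comm (x ⁻¹) x) (⁻¹-inverseʳ x x≉0)) ⟨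
    (x ⁻¹ * x) * y    ≈⟨ *-assoc _ _ _ ⟩
    x ⁻¹ * (x * y)    ≈⟨ *-congˡ x*y≈0 ⟩
    x ⁻¹ * 0#         ≈⟨ zeroʳ _ ⟩
    0#                ∎

  private
    x*z≈y*z⇒[x-y]*z≈0 : ∀ {x y z} → x * z ≈ y * z → (x - y) * z ≈ 0#
    x*z≈y*z⇒[x-y]*z≈0 {x} {y} {z} xz≈yz = begin
      (x - y) * z       ≈⟨ [y-z]x≈yx-zx z x y ⟩
      x * z - y * z     ≈⟨ +-congʳ xz≈yz ⟩
      y * z - y * z     ≈⟨ -‿inverseʳ _ ⟩
      0#                ∎

  *-cancelʳ : ∀ {x y z} → ¬ z ≈ 0# → x * z ≈ y * z → x ≈ y
  *-cancelʳ {x} {y} z≉0 xz≈yz =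
    x∙y⁻¹≈ε⇒x≈y x y (x≉0∧x*y≈0⇒y≈0 z≉0 (trans (*-comm _ _) (x*z≈y*z⇒[x-y]*z≈0 xz≈yz)))

  *-cancelʳ-≉ : ∀ {x y z} → ¬ x ≈ y → x * z ≈ y * z → z ≈ 0#
  *-cancelʳ-≉ {x} {y} x≉y xz≈yz = x≉0∧x*y≈0⇒y≈0 (x≉y ∘ x∙y⁻¹≈ε⇒x≈y x y) (x*z≈y*z⇒[x-y]*z≈0 xz≈yz)

  x*y≈1⇒x≉0 : ∀ {x y} → x * y ≈ 1# → ¬ x ≈ 0#
  x*y≈1⇒x≉0 {x} {y} x*y≈1 x≈0 = 1≉0 (trans (sym x*y≈1) (trans (*-congʳ x≈0) (zeroˡ y)))

  x*y≈1⇒y≈x⁻¹ : ∀ {x y} → x * y ≈ 1# → y ≈ x ⁻¹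
  x*y≈1⇒y≈x⁻¹ {x} {y} x*y≈1 = *-cancelʳ x≉0 (begin
    y * x             ≈⟨ *-comm y x ⟩
    x * y             ≈⟨ x*y≈1 ⟩
    1#                ≈⟨ ⁻¹-inverseʳ x x≉0 ⟨
    x * x ⁻¹          ≈⟨ *-comm x _ ⟩
    x ⁻¹ * x          ∎)
    where x≉0 = x*y≈1⇒x≉0 x*y≈1

module _ {ℓ₁ ℓ₂} (F : Field ℓ₁ ℓ₂) {N : ℕ} (enum : Inverse (Field.setoid F) (≡-setoid (Fin N))) where
  open Field F
  open import Relation.Binary.Reasoning.Setoid setoid
  open import Relation.Binary.Definitions using (Decidable)
  open import Algebra.Properties.Ring ring using (+-identityʳ-unique)
  open import Algebra.Properties.CommutativeMonoid.Sum +-commutativeMonoid using (∑-distrib-+; sum-replicate)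
  open Inverse enum using (to; from; to-cong; from-cong; strictlyInverseʳ)

  ≈-dec : Decidable _≈_
  ≈-dec x y with to x Fin.≟ to y
  ... | yes tx≡ty = yes (trans (sym (strictlyInverseʳ x)) (trans (from-cong tx≡ty) (strictlyInverseʳ y)))
  ... | no tx≢ty  = no (tx≢ty ∘ to-cong)

  card×1≈0 : N × 1# ≈ 0#
  card×1≈0 = +-identityʳ-unique Σx (N × 1#) (sym (begin
    Σx                                ≈⟨ sumOver-reindex +-commutativeMonoid enum translation id ⟩
    sumOver +-commutativeMonoid enum (λ x → x + 1#)
                                      ≈⟨ ∑-distrib-+ from (λ _ → 1#) ⟩
    Σx + sum {N} (λ _ → 1#)           ≈⟨ +-congˡ (sum-replicate N) ⟩
    Σx + N × 1#                       ∎))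
    where
    Σx = sumOver +-commutativeMonoid enum (λ x → x)
    translation : Inverse setoid setoid
    translation = mkPermutation setoid (_+ 1#) (_- 1#) +-congʳ +-congʳ
      (λ x → trans (+-assoc _ _ _) (trans (+-congˡ (-‿inverseˡ 1#)) (+-identityʳ x)))
      (λ x → trans (+-assoc _ _ _) (trans (+-congˡ (-‿inverseʳ 1#)) (+-identityʳ x)))

  x^n≈0⇒x≈0 : ∀ {x} n → x ^ᶠ n ≈ 0# → x ≈ 0#
  x^n≈0⇒x≈0       zero    1≈0     = contradiction 1≈0 1≉0
  x^n≈0⇒x≈0 {x} (suc n) x*xⁿ≈0 with ≈-dec x 0#
  ... | yes x≈0 = x≈0
  ... | no  x≉0 = x^n≈0⇒x≈0 n (x≉0∧x*y≈0⇒y≈0 F x≉0 x*xⁿ≈0)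

  card≡m^e⇒m×1≈0 : ∀ {m e} → N ≡ m ℕ.^ e → m × 1# ≈ 0#
  card≡m^e⇒m×1≈0 {m} {e} N≡mᵉ = x^n≈0⇒x≈0 e (begin
    (m × 1#) ^ᶠ e        ≈⟨ ×1-homo-^ commutativeRing m e ⟨
    (m ℕ.^ e) × 1#       ≡⟨ ≡.cong (_× 1#) N≡mᵉ ⟨
    N × 1#               ≈⟨ card×1≈0 ⟩
    0#                   ∎)

module _ {ℓ₁ ℓ₂} (F : Field ℓ₁ ℓ₂) {n : ℕ} (enum : Inverse (Field.setoid F) (≡-setoid (Fin (suc n)))) where
  open Field F
  open import Relation.Binary.Reasoning.Setoid setoid
  open import Algebra.Properties.CommutativeMonoid.Sum *-commutativeMonoid
    using (sum-remove; sum-cong-≋; ∑-distrib-+; sum-replicate) renaming (sum to product)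
  open import Data.Fin.Properties using (punchInᵢ≢i)
  open import Function.Definitions using (Congruent)
  open Inverse enum using (to; from; to-cong; strictlyInverseʳ; strictlyInverseˡ)

  private
    productOver : (Carrier → Carrier) → Carrier
    productOver = sumOver *-commutativeMonoid enum

    nonzero : Fin n → Carrier
    nonzero j = from (Fin.punchIn (to 0#) j)

    nonzero-≉0 : ∀ j → ¬ nonzero j ≈ 0#
    nonzero-≉0 j e = punchInᵢ≢i (to 0#) j (≡.trans (≡.sym (strictlyInverseˡ _)) (to-cong e))

    productOver-split : ∀ {g} → Congruent _≈_ _≈_ g → productOver g ≈ g 0# * product (g ∘ nonzero)
    productOver-split {g} g-cong = trans (sum-remove {i = to 0#} (g ∘ from)) (*-congʳ (g-cong (strictlyInverseʳ 0#)))

    product-≉0 : ∀ {m} (f : Fin m → Carrier) → (∀ j → ¬ f j ≈ 0#) → ¬ product f ≈ 0#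
    product-≉0 {zero}  f f≉0 = 1≉0
    product-≉0 {suc m} f f≉0 Πf≈0 = product-≉0 (f ∘ Fin.suc) (f≉0 ∘ Fin.suc) (x≉0∧x*y≈0⇒y≈0 F (f≉0 Fin.zero) Πf≈0)

    -- Replacing 0 by 1 turns the product of the nonzero elements into a product over all of 𝔽,
    -- which is invariant under the permutation x ↦ a x.
    zeroTo1 : Carrier → Carrier
    zeroTo1 x with ≈-dec F enum x 0#
    ... | yes _ = 1#
    ... | no  _ = x

    zeroTo1-cong : Congruent _≈_ _≈_ zeroTo1
    zeroTo1-cong {x} {y} x≈y with ≈-dec F enum x 0# | ≈-dec F enum y 0#
    ... | yes _   | yes _   = refl
    ... | yes x≈0 | no  y≉0 = contradiction (trans (sym x≈y) x≈0) y≉0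
    ... | no  x≉0 | yes y≈0 = contradiction (trans x≈y y≈0) x≉0
    ... | no  _   | no  _   = x≈y

    zeroTo1-≈0 : ∀ {x} → x ≈ 0# → zeroTo1 x ≈ 1#
    zeroTo1-≈0 {x} x≈0 with ≈-dec F enum x 0#
    ... | yes _   = refl
    ... | no  x≉0 = contradiction x≈0 x≉0

    zeroTo1-≉0 : ∀ {x} → ¬ x ≈ 0# → zeroTo1 x ≈ x
    zeroTo1-≉0 {x} x≉0 with ≈-dec F enum x 0#
    ... | yes x≈0 = contradiction x≈0 x≉0
    ... | no  _   = refl

    scaling : ∀ {a} → ¬ a ≈ 0# → Inverse setoid setoid
    scaling {a} a≉0 = mkPermutation setoid (a *_) (a ⁻¹ *_) *-congˡ *-congˡ
      (λ x → trans (sym (*-assoc _ _ _)) (trans (*-congʳ (⁻¹-inverseʳ a a≉0)) (*-identityˡ x)))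
      (λ x → trans (sym (*-assoc _ _ _)) (trans (*-congʳ (trans (*-comm _ _) (⁻¹-inverseʳ a a≉0))) (*-identityˡ x)))

  x^[1+n]≈x : ∀ x → x ^ᶠ suc n ≈ x
  x^[1+n]≈x a with ≈-dec F enum a 0#
  ... | yes a≈0 = trans (*-congʳ a≈0) (trans (zeroˡ _) (sym a≈0))
  ... | no  a≉0 = trans (*-congˡ aⁿ≈1) (*-identityʳ a)
    where
    Π = product nonzero
    aⁿ≈1 : a ^ᶠ n ≈ 1#
    aⁿ≈1 = *-cancelʳ F (product-≉0 nonzero nonzero-≉0) (begin
      a ^ᶠ n * Π                                 ≈⟨ *-congʳ (sum-replicate n) ⟨
      product {n} (λ _ → a) * Π                  ≈⟨ ∑-distrib-+ {n} (λ _ → a) nonzero ⟨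
      product (λ j → a * nonzero j)              ≈⟨ sum-cong-≋ {n} (λ j → zeroTo1-≉0 (nonzero-≉0 j ∘ x≉0∧x*y≈0⇒y≈0 F a≉0)) ⟨
      product (λ j → zeroTo1 (a * nonzero j))    ≈⟨ *-identityˡ _ ⟨
      1# * product (λ j → zeroTo1 (a * nonzero j))
                                                 ≈⟨ *-congʳ (zeroTo1-≈0 (zeroʳ a)) ⟨
      zeroTo1 (a * 0#) * product (λ j → zeroTo1 (a * nonzero j))
                                                 ≈⟨ productOver-split (zeroTo1-cong ∘ *-congˡ) ⟨
      productOver (zeroTo1 ∘ (a *_))             ≈⟨ sumOver-reindex *-commutativeMonoid enum (scaling a≉0) zeroTo1-cong ⟨
      productOver zeroTo1                        ≈⟨ productOver-split zeroTo1-cong ⟩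
      zeroTo1 0# * product (zeroTo1 ∘ nonzero)   ≈⟨ *-cong (zeroTo1-≈0 refl) (sum-cong-≋ {n} (zeroTo1-≉0 ∘ nonzero-≉0)) ⟩
      1# * Π                                     ∎)

x^card≈x : ∀ {ℓ₁ ℓ₂} (F : Field ℓ₁ ℓ₂) {N} → Inverse (Field.setoid F) (≡-setoid (Fin N)) →
           ∀ x → Field._≈_ F (Field._^ᶠ_ F x N) x
x^card≈x F {zero}  enum with Inverse.to enum (Field.0# F)
... | ()
x^card≈x F {suc n} enum = x^[1+n]≈x F enum

module RootOfUnity {ℓ₁ ℓ₂} (F : Field ℓ₁ ℓ₂) {n : ℕ} {ω : Field.Carrier F}
                   (ωᵈ≈1 : Field._≈_ F (Field._^ᶠ_ F ω (suc n)) (Field.1# F)) where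
  open Field F
  open import Relation.Binary.Reasoning.Setoid setoid
  open import Algebra.Properties.Semiring.Exp semiring using (^-homo-*; ^-congʳ; ^-assocʳ)
  open import Data.Nat using (_≤_; _<_; z≤n; s≤s)
  open import Data.Nat.Properties using (*-suc; ≤-total; m+[n∸m]≡n)
  open import Data.Nat.Divisibility using (_∣_; divides; m%n≡0⇒n∣m)
  open import Data.Nat.DivMod using (_%_; _/_; m≡m%n+[m/n]*n; m%n<n)
  open import Data.Integer as ℤ using (+_; ∣_∣)
  open import Data.Integer.Properties using ([+m]-[+n]≡m⊖n; ∣⊖∣-≤; ∣i-j∣≡∣j-i∣)
  open import Data.Integer.Divisibility using () renaming (_∣_ to _∣ℤ_)

  ω^[k*d]≈1 : ∀ k → ω ^ᶠ (k ℕ.* suc n) ≈ 1#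
  ω^[k*d]≈1 zero    = refl
  ω^[k*d]≈1 (suc k) = begin
    ω ^ᶠ (suc n ℕ.+ k ℕ.* suc n)           ≈⟨ ^-homo-* ω (suc n) (k ℕ.* suc n) ⟩
    ω ^ᶠ suc n * ω ^ᶠ (k ℕ.* suc n)        ≈⟨ *-cong ωᵈ≈1 (ω^[k*d]≈1 k) ⟩
    1# * 1#                                ≈⟨ *-identityˡ 1# ⟩
    1#                                     ∎

  [ω^a]ᵈ≈1 : ∀ a → (ω ^ᶠ a) ^ᶠ suc n ≈ 1#
  [ω^a]ᵈ≈1 a = trans (^-assocʳ ω a (suc n)) (ω^[k*d]≈1 a)

  ω^[m+k*d]≈ω^m : ∀ m k → ω ^ᶠ (m ℕ.+ k ℕ.* suc n) ≈ ω ^ᶠ m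
  ω^[m+k*d]≈ω^m m k = begin
    ω ^ᶠ (m ℕ.+ k ℕ.* suc n)               ≈⟨ ^-homo-* ω m (k ℕ.* suc n) ⟩
    ω ^ᶠ m * ω ^ᶠ (k ℕ.* suc n)            ≈⟨ *-congˡ (ω^[k*d]≈1 k) ⟩
    ω ^ᶠ m * 1#                            ≈⟨ *-identityʳ _ ⟩
    ω ^ᶠ m                                 ∎

  ω^a*ω^[a*n]≈1 : ∀ a → ω ^ᶠ a * ω ^ᶠ (a ℕ.* n) ≈ 1#
  ω^a*ω^[a*n]≈1 a = begin
    ω ^ᶠ a * ω ^ᶠ (a ℕ.* n)                ≈⟨ ^-homo-* ω a (a ℕ.* n) ⟨
    ω ^ᶠ (a ℕ.+ a ℕ.* n)                   ≈⟨ ^-congʳ ω (*-suc a n) ⟨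
    ω ^ᶠ (a ℕ.* suc n)                     ≈⟨ ω^[k*d]≈1 a ⟩
    1#                                     ∎

  ω^≉0 : ∀ a → ¬ ω ^ᶠ a ≈ 0#
  ω^≉0 a = x*y≈1⇒x≉0 F (ω^a*ω^[a*n]≈1 a)

  ω^[a*n]≈[ω^a]⁻¹ : ∀ a → ω ^ᶠ (a ℕ.* n) ≈ (ω ^ᶠ a) ⁻¹
  ω^[a*n]≈[ω^a]⁻¹ a = x*y≈1⇒y≈x⁻¹ F (ω^a*ω^[a*n]≈1 a)

  ∣+a-+b∣≡b∸a : ∀ {a b} → a ≤ b → ∣ + a ℤ.- + b ∣ ≡ b ℕ.∸ a
  ∣+a-+b∣≡b∸a {a} {b} a≤b = ≡.trans (≡.cong ∣_∣ ([+m]-[+n]≡m⊖n a b)) (∣⊖∣-≤ a≤b)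

  private
    d∣∣a-b∣⇒ω^b≈ω^a : ∀ {a b} → a ≤ b → suc n ∣ ∣ + a ℤ.- + b ∣ → ω ^ᶠ b ≈ ω ^ᶠ a
    d∣∣a-b∣⇒ω^b≈ω^a {a} {b} a≤b (divides k ∣a-b∣≡kd) = begin
      ω ^ᶠ b                               ≡⟨ ≡.cong (ω ^ᶠ_) (m+[n∸m]≡n a≤b) ⟨
      ω ^ᶠ (a ℕ.+ (b ℕ.∸ a))               ≡⟨ ≡.cong (λ t → ω ^ᶠ (a ℕ.+ t)) (≡.trans (≡.sym (∣+a-+b∣≡b∸a a≤b)) ∣a-b∣≡kd) ⟩
      ω ^ᶠ (a ℕ.+ k ℕ.* suc n)             ≈⟨ ω^[m+k*d]≈ω^m a k ⟩
      ω ^ᶠ a                               ∎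

  d∣a-b⇒ω^a≈ω^b : ∀ a b → (+ suc n) ∣ℤ (+ a ℤ.- + b) → ω ^ᶠ a ≈ ω ^ᶠ b
  d∣a-b⇒ω^a≈ω^b a b d∣a-b with ≤-total a b
  ... | inj₁ a≤b = sym (d∣∣a-b∣⇒ω^b≈ω^a a≤b d∣a-b)
  ... | inj₂ b≤a = d∣∣a-b∣⇒ω^b≈ω^a b≤a (≡.subst (suc n ∣_) (∣i-j∣≡∣j-i∣ (+ a) (+ b)) d∣a-b)

  module _ (ω-primitive : ∀ k → 1 ≤ k → k < suc n → ¬ ω ^ᶠ k ≈ 1#) where

    ω^t≈1⇒d∣t : ∀ t → ω ^ᶠ t ≈ 1# → suc n ∣ t
    ω^t≈1⇒d∣t t ωᵗ≈1 = m%n≡0⇒n∣m t (suc n) (r≡0 (t % suc n) (m%n<n t (suc n)) ωʳ≈1)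
      where
      ωʳ≈1 : ω ^ᶠ (t % suc n) ≈ 1#
      ωʳ≈1 = begin
        ω ^ᶠ (t % suc n)                           ≈⟨ ω^[m+k*d]≈ω^m (t % suc n) (t / suc n) ⟨
        ω ^ᶠ (t % suc n ℕ.+ (t / suc n) ℕ.* suc n) ≡⟨ ≡.cong (ω ^ᶠ_) (m≡m%n+[m/n]*n t (suc n)) ⟨
        ω ^ᶠ t                                     ≈⟨ ωᵗ≈1 ⟩
        1#                                         ∎
      r≡0 : ∀ r → r < suc n → ω ^ᶠ r ≈ 1# → r ≡ 0
      r≡0 zero    _   _    = ≡.refl
      r≡0 (suc r) r<d ωʳ≈1 = contradiction ωʳ≈1 (ω-primitive (suc r) (s≤s z≤n) r<d)

    private
      ω^[a+t]≈ω^a⇒d∣t : ∀ a t → ω ^ᶠ (a ℕ.+ t) ≈ ω ^ᶠ a → suc n ∣ t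
      ω^[a+t]≈ω^a⇒d∣t a t e = ω^t≈1⇒d∣t t (*-cancelʳ F (ω^≉0 a) (begin
        ω ^ᶠ t * ω ^ᶠ a                  ≈⟨ *-comm _ _ ⟩
        ω ^ᶠ a * ω ^ᶠ t                  ≈⟨ ^-homo-* ω a t ⟨
        ω ^ᶠ (a ℕ.+ t)                   ≈⟨ e ⟩
        ω ^ᶠ a                           ≈⟨ *-identityˡ _ ⟨
        1# * ω ^ᶠ a                      ∎))

      ω^a≈ω^b⇒d∣∣a-b∣ : ∀ {a b} → a ≤ b → ω ^ᶠ a ≈ ω ^ᶠ b → suc n ∣ ∣ + a ℤ.- + b ∣
      ω^a≈ω^b⇒d∣∣a-b∣ {a} {b} a≤b e = ≡.subst (suc n ∣_) (≡.sym (∣+a-+b∣≡b∸a a≤b))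
        (ω^[a+t]≈ω^a⇒d∣t a (b ℕ.∸ a) (trans (^-congʳ ω (m+[n∸m]≡n a≤b)) (sym e)))

    ω^a≈ω^b⇒d∣a-b : ∀ a b → ω ^ᶠ a ≈ ω ^ᶠ b → (+ suc n) ∣ℤ (+ a ℤ.- + b)
    ω^a≈ω^b⇒d∣a-b a b e with ≤-total a b
    ... | inj₁ a≤b = ω^a≈ω^b⇒d∣∣a-b∣ a≤b e
    ... | inj₂ b≤a = ≡.subst (suc n ∣_) (∣i-j∣≡∣j-i∣ (+ b) (+ a)) (ω^a≈ω^b⇒d∣∣a-b∣ b≤a (sym e))

module LinearizedPolynomial {ℓ₁ ℓ₂} (F : Field ℓ₁ ℓ₂) (q n : ℕ) {ω : Field.Carrier F}
                            (ωᵈ≈1 : Field._≈_ F (Field._^ᶠ_ F ω (suc n)) (Field.1# F)) where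
  open Field F
  open RootOfUnity F {n} ωᵈ≈1
  open import Relation.Binary.Reasoning.Setoid setoid
  open import Algebra.Properties.Semiring.Exp semiring using (^-assocʳ; ^-homo-*; ^-congˡ)
  open import Algebra.Properties.Semiring.Mult semiring using (×-assoc-*)
  open import Algebra.Properties.CommutativeSemigroup *-commutativeSemigroup using (x∙yz≈y∙xz)
  open import Algebra.Properties.Semiring.Sum semiring using (sum-cong-≋; *-distribʳ-sum; *-distribˡ-sum; sum-replicate)
  open import Algebra.Properties.CommutativeSemiring.Exp commutativeSemiring using (^-distrib-*)
  open import Data.Fin.Properties using (toℕ≤pred[n])
  open import Data.Nat.Properties using (+-∸-assoc; m+[n∸m]≡n)
  import Data.Nat.Properties as ℕ

  private
    Aᵢ : ℕ → Carrier → Carrier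
    Aᵢ = A F q (suc n) ω

    [1+n]∸k≡1+[n∸k] : ∀ (k : Fin (suc n)) → suc n ℕ.∸ toℕ k ≡ suc (n ℕ.∸ toℕ k)
    [1+n]∸k≡1+[n∸k] k = +-∸-assoc 1 (toℕ≤pred[n] k)


  module _ {c y} (c^q≈c : c ^ᶠ q ≈ c) (y^q≈c*y : y ^ᶠ q ≈ c * y) (j : ℕ) where
    private
      s : Fin (suc n) → Carrier
      s k = (ω ^ᶠ j) ^ᶠ toℕ k * c ^ᶠ (n ℕ.∸ toℕ k)

      S : Carrier
      S = sum s

    A-eigenvector : Aᵢ j y ≈ S * y
    A-eigenvector = begin
      Aᵢ j y                          ≈⟨ sum-cong-≋ {suc n} term ⟩
      sum {suc n} (λ k → s k * y)     ≈⟨ *-distribʳ-sum y s ⟨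
      S * y                           ∎
      where
      term : ∀ (k : Fin (suc n)) → ω ^ᶠ (j ℕ.* toℕ k) * y ^ᶠ (q ℕ.^ (n ℕ.∸ toℕ k)) ≈ s k * y
      term k = trans (*-cong (sym (^-assocʳ ω j (toℕ k))) (y^q≈c*y⇒y^[q^t]≈cᵗ*y commutativeRing c^q≈c y^q≈c*y (n ℕ.∸ toℕ k)))
                     (sym (*-assoc _ _ _))

    A-eigenvector-≈ : ω ^ᶠ j ≈ c → Aᵢ j y ≈ suc n × ((ω ^ᶠ j) ⁻¹ * y)
    A-eigenvector-≈ ωʲ≈c = begin
      Aᵢ j y                                  ≈⟨ A-eigenvector ⟩
      S * y                                   ≈⟨ *-congʳ (trans (sum-cong-≋ {suc n} term) (sum-replicate (suc n))) ⟩
      (suc n × (ω ^ᶠ j) ⁻¹) * y               ≈⟨ ×-assoc-* (suc n) _ y ⟩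
      suc n × ((ω ^ᶠ j) ⁻¹ * y)               ∎
      where
      term : ∀ (k : Fin (suc n)) → s k ≈ (ω ^ᶠ j) ⁻¹
      term k = begin
        (ω ^ᶠ j) ^ᶠ toℕ k * c ^ᶠ (n ℕ.∸ toℕ k)              ≈⟨ *-congˡ (^-congˡ (n ℕ.∸ toℕ k) ωʲ≈c) ⟨
        (ω ^ᶠ j) ^ᶠ toℕ k * (ω ^ᶠ j) ^ᶠ (n ℕ.∸ toℕ k)       ≈⟨ ^-homo-* (ω ^ᶠ j) (toℕ k) (n ℕ.∸ toℕ k) ⟨
        (ω ^ᶠ j) ^ᶠ (toℕ k ℕ.+ (n ℕ.∸ toℕ k))               ≡⟨ ≡.cong ((ω ^ᶠ j) ^ᶠ_) (m+[n∸m]≡n (toℕ≤pred[n] k)) ⟩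
        (ω ^ᶠ j) ^ᶠ n                                       ≈⟨ ^-assocʳ ω j n ⟩
        ω ^ᶠ (j ℕ.* n)                                      ≈⟨ ω^[a*n]≈[ω^a]⁻¹ j ⟩
        (ω ^ᶠ j) ⁻¹                                         ∎

    A-eigenvector-≉ : c ^ᶠ suc n ≈ 1# → ¬ ω ^ᶠ j ≈ c → Aᵢ j y ≈ 0#
    A-eigenvector-≉ cᵈ≈1 ωʲ≉c = begin
      Aᵢ j y            ≈⟨ A-eigenvector ⟩
      S * y             ≈⟨ *-congʳ S≈0 ⟩
      0# * y            ≈⟨ zeroˡ y ⟩
      0#                ∎
      where
      S≈0 : S ≈ 0#
      S≈0 = *-cancelʳ-≉ F ωʲ≉c (begin
        ω ^ᶠ j * S                                                      ≈⟨ sum-rotate commutativeRing {n} (ω ^ᶠ j) (c ^ᶠ_) ([ω^a]ᵈ≈1 j) cᵈ≈1 ⟨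
        sum {suc n} (λ k → (ω ^ᶠ j) ^ᶠ toℕ k * c ^ᶠ (suc n ℕ.∸ toℕ k))  ≈⟨ sum-cong-≋ {suc n} term ⟩
        sum {suc n} (λ k → c * s k)                                     ≈⟨ *-distribˡ-sum c s ⟨
        c * S                                                           ∎)
        where
        term : ∀ (k : Fin (suc n)) → (ω ^ᶠ j) ^ᶠ toℕ k * c ^ᶠ (suc n ℕ.∸ toℕ k) ≈ c * s k
        term k rewrite [1+n]∸k≡1+[n∸k] k = x∙yz≈y∙xz _ c _

  module Frobenius (^q-distrib-+ : ∀ x y → (x + y) ^ᶠ q ≈ x ^ᶠ q + y ^ᶠ q)
                   (x^[q^d]≈x : ∀ x → x ^ᶠ (q ℕ.^ suc n) ≈ x) (ω^q≈ω : ω ^ᶠ q ≈ ω) where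

    A-^q : ∀ i x → Aᵢ i x ^ᶠ q ≈ ω ^ᶠ i * Aᵢ i x
    A-^q i x = begin
      Aᵢ i x ^ᶠ q
        ≈⟨ ^-distrib-sum commutativeRing {q} ^q-distrib-+ t ⟩
      sum {suc n} (λ k → t k ^ᶠ q)
        ≈⟨ sum-cong-≋ {suc n} frobenius-term ⟩
      sum {suc n} (λ k → (ω ^ᶠ i) ^ᶠ toℕ k * b (suc n ℕ.∸ toℕ k))
        ≈⟨ sum-rotate commutativeRing {n} (ω ^ᶠ i) b ([ω^a]ᵈ≈1 i) (trans (x^[q^d]≈x x) (sym (*-identityʳ x))) ⟩
      ω ^ᶠ i * sum {suc n} (λ k → (ω ^ᶠ i) ^ᶠ toℕ k * b (n ℕ.∸ toℕ k))
        ≈⟨ *-congˡ (sum-cong-≋ {suc n} (λ k → *-cong (^-assocʳ ω i (toℕ k)) (refl {b (n ℕ.∸ toℕ k)}))) ⟩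
      ω ^ᶠ i * Aᵢ i x
        ∎
      where
      b : ℕ → Carrier
      b e = x ^ᶠ (q ℕ.^ e)
      t : Fin (suc n) → Carrier
      t k = ω ^ᶠ (i ℕ.* toℕ k) * b (n ℕ.∸ toℕ k)
      frobenius-term : ∀ k → t k ^ᶠ q ≈ (ω ^ᶠ i) ^ᶠ toℕ k * b (suc n ℕ.∸ toℕ k)
      frobenius-term k = begin
        (ω ^ᶠ (i ℕ.* toℕ k) * b (n ℕ.∸ toℕ k)) ^ᶠ q                   ≈⟨ ^-distrib-* _ _ q ⟩
        (ω ^ᶠ (i ℕ.* toℕ k)) ^ᶠ q * b (n ℕ.∸ toℕ k) ^ᶠ q              ≈⟨ *-congʳ (x^q≈x⇒[x^a]^q≈x^a commutativeRing {q} ω^q≈ω (i ℕ.* toℕ k)) ⟩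
        ω ^ᶠ (i ℕ.* toℕ k) * b (n ℕ.∸ toℕ k) ^ᶠ q                     ≈⟨ *-cong (sym (^-assocʳ ω i (toℕ k))) (^-assocʳ x (q ℕ.^ (n ℕ.∸ toℕ k)) q) ⟩
        (ω ^ᶠ i) ^ᶠ toℕ k * x ^ᶠ (q ℕ.^ (n ℕ.∸ toℕ k) ℕ.* q)          ≡⟨ ≡.cong (λ e → (ω ^ᶠ i) ^ᶠ toℕ k * x ^ᶠ e) (ℕ.*-comm (q ℕ.^ (n ℕ.∸ toℕ k)) q) ⟩
        (ω ^ᶠ i) ^ᶠ toℕ k * b (suc (n ℕ.∸ toℕ k))                     ≡⟨ ≡.cong (λ e → (ω ^ᶠ i) ^ᶠ toℕ k * b e) ([1+n]∸k≡1+[n∸k] k) ⟨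
        (ω ^ᶠ i) ^ᶠ toℕ k * b (suc n ℕ.∸ toℕ k)                       ∎

    Aᵐ-^q : ∀ i m x → (Aᵢ i x ^ᶠ m) ^ᶠ q ≈ ω ^ᶠ (i ℕ.* m) * Aᵢ i x ^ᶠ m
    Aᵐ-^q i m x = trans (y^q≈a*y⇒[yᵐ]^q≈aᵐ*yᵐ commutativeRing {q} (A-^q i x) m) (*-congʳ (^-assocʳ ω i m))

    private
      ω^im^q≈ω^im : ∀ i m → (ω ^ᶠ (i ℕ.* m)) ^ᶠ q ≈ ω ^ᶠ (i ℕ.* m)
      ω^im^q≈ω^im i m = x^q≈x⇒[x^a]^q≈x^a commutativeRing {q} ω^q≈ω (i ℕ.* m)

    A[Aᵐ]-≈ : ∀ i m j x → ω ^ᶠ j ≈ ω ^ᶠ (i ℕ.* m) → Aᵢ j (Aᵢ i x ^ᶠ m) ≈ suc n × ((ω ^ᶠ j) ⁻¹ * Aᵢ i x ^ᶠ m)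
    A[Aᵐ]-≈ i m j x = A-eigenvector-≈ (ω^im^q≈ω^im i m) (Aᵐ-^q i m x) j

    A[Aᵐ]-≉ : ∀ i m j x → ¬ ω ^ᶠ j ≈ ω ^ᶠ (i ℕ.* m) → Aᵢ j (Aᵢ i x ^ᶠ m) ≈ 0#
    A[Aᵐ]-≉ i m j x = A-eigenvector-≉ (ω^im^q≈ω^im i m) (Aᵐ-^q i m x) j ([ω^a]ᵈ≈1 (i ℕ.* m))

open import Data.Nat using (_<_; _≤_; _*_; _∸_; _^_)
open import Data.Product using (_×_; ∃₂)
open import Data.Integer using (+_; _-_)
open import Data.Integer.Divisibility using () renaming (_∣_ to _∣ℤ_)
open import Data.Nat.Divisibility using (_∣_)
open import Data.Nat.Properties using (^-*-assoc)

lemma6p1 : ∀ {c ℓ : Level} (d q : ℕ) → 1 < d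
    → ∃₂ (λ p k → Prime p × 1 ≤ k × q ≡ p ^ k)
    → d ∣ (q ∸ 1)
    → (F : Field c ℓ)
    → Inverse (Field.setoid F) (≡-setoid (Fin (q ^ d)))
    → (ω : Field.Carrier F)
    → Field._≈_ F (Field._^ᶠ_ F ω q) ω
    → Field._≈_ F (Field._^ᶠ_ F ω d) (Field.1# F)
    → (∀ k → 1 ≤ k → k < d → ¬ Field._≈_ F (Field._^ᶠ_ F ω k) (Field.1# F))
    → (∀ i → i < d → ∀ x →
         Field._≈_ F (Field._^ᶠ_ F (A F q d ω i x) q)
                     (Field._*_ F (Field._^ᶠ_ F ω i) (A F q d ω i x)))
      × (∀ m → 1 ≤ m → ∀ i j → i < d → j < d → ∀ x →
         ((+ d) ∣ℤ (+ j - + (i * m)) →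
            Field._≈_ F (A F q d ω j (Field._^ᶠ_ F (A F q d ω i x) m))
                        (Field._×_ F d (Field._*_ F (Field._⁻¹ F (Field._^ᶠ_ F ω j))
                                                    (Field._^ᶠ_ F (A F q d ω i x) m))))
         × (¬ ((+ d) ∣ℤ (+ j - + (i * m))) →
            Field._≈_ F (A F q d ω j (Field._^ᶠ_ F (A F q d ω i x) m)) (Field.0# F)))
lemma6p1 zero    _ () _ _ _ _ _ _ _ _
lemma6p1 (suc n) _ _ (p , k , p-prime , _ , ≡.refl) _ F enum ω ω^q≈ω ωᵈ≈1 ω-primitive =
    (λ i _ → A-^q i)
  , λ m _ i j _ _ x →
        (λ d∣j-im → A[Aᵐ]-≈ i m j x (d∣a-b⇒ω^a≈ω^b j (i * m) d∣j-im))
      , (λ d∤j-im → A[Aᵐ]-≉ i m j x (d∤j-im ∘ ω^a≈ω^b⇒d∣a-b ω-primitive j (i * m)))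
  where
  open RootOfUnity F {n} ωᵈ≈1
  open LinearizedPolynomial F (p ^ k) n ωᵈ≈1
  p×1≈0 : Field._≈_ F (Field._×_ F p (Field.1# F)) (Field.0# F)
  p×1≈0 = card≡m^e⇒m×1≈0 F enum {p} {k * suc n} (^-*-assoc p k (suc n))
  open Frobenius (^[p^e]-distrib-+ (Field.commutativeRing F) p-prime p×1≈0 k) (x^card≈x F enum) ω^q≈ω
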